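{- Let $\Gamma$ be a directed strongly regular graph with parameters $(n,k,t,\lambda,\mu)$ and $\bar\Gamma$ its complement, with parameters $(n,\bar k,\bar t,\bar\lambda,\bar\mu)$. Suppose that $\mu+\bar\mu=n/2$ and that $\pi$ is a homogeneous column-equitable partition with two cells which is good for $\Gamma$. Then $\pi$ is also good for $\bar\Gamma$.
   Context: A directed strongly regular graph (DSRG) with parameters $(n,k,t,\lambda,\mu)$ is a loopless digraph on $n$ vertices whose adjacency matrix $A$ satisfies $AJ=JA=kJ$ and $A^2=tI+\lambda A+\mu(J-I-A)$. The complement $\bar\Gamma$ has adjacency matrix $J-I-A$ and is a DSRG with $\bar k=n-k-1$, $\bar t=n-2k+t-1$, $\bar\lambda=n-2k+\mu-2$, $\bar\mu=n-2k+\lambda$. A partition $\{C_1,\dots,C_a\}$ is column equitable if for all $i,l$ the number of arcs from vertices of $C_i$ to a vertex $v\in C_l$ depends only on $i,l$; it is homogeneous if all cells have the same size. The $\pi$-join $\Gamma^1_\pi$ for a homogeneous partition $\pi=\{C_1,\dots,C_a\}$ is the digraph with vertex set $V(\Gamma)\times\{0,1,\ldots,a\}$ and arcs: $(u,r)\to(v,r)$ whenever $u\to v$ in $\Gamma$; and for every $(u,r)$ and every $i$, arcs from $(u,r)$ to all $(v,r+i \bmod (a+1))$ with $v\in C_i$; no other arcs. $\pi$ is good for $\Gamma$ if $\Gamma^1_\pi$ is a DSRG. -}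

module Defs where

open import Data.Nat using (ℕ; zero; suc; _+_; _*_)
open import Data.Nat.DivMod using (_%_)
open import Data.Bool using (Bool; true; false; _∧_; not; if_then_else_)
open import Data.Fin using (Fin; zero; suc; toℕ; remQuot)
open import Data.Product using (_×_; _,_; ∃)
open import Relation.Binary.PropositionalEquality using (_≡_)
open import Relation.Nullary using (¬_)
open import Relation.Nullary.Decidable using (⌊_⌋)
import Data.Nat as ℕ
import Data.Fin as F

-- A digraph on the vertex set Fin n, given by its 0/1 adjacency matrix
-- (A u v = true  iff  there is an arc u → v).
Digraph : ℕ → Set
Digraph n = Fin n → Fin n → Bool

count : ∀ {n} → (Fin n → Bool) → ℕ
count {zero}  p = 0
count {suc n} p = (if p zero then 1 else 0) + count (λ i → p (suc i))

paths2 : ∀ {n} → Digraph n → Fin n → Fin n → ℕ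
paths2 A u w = count (λ x → A u x ∧ A x w)

-- Directed strongly regular graph with parameters (n,k,t,λ,μ):
--   loopless, AJ = kJ, JA = kJ, and A² = tI + λA + μ(J − I − A), entrywise.
record IsDSRG {n : ℕ} (A : Digraph n) (k t λ' μ : ℕ) : Set where
  field
    loopless  : ∀ v → A v v ≡ false
    outDegree : ∀ u → count (λ v → A u v) ≡ k
    inDegree  : ∀ v → count (λ u → A u v) ≡ k
    sq-diag   : ∀ u → paths2 A u u ≡ t
    sq-arc    : ∀ u w → A u w ≡ true → paths2 A u w ≡ λ'
    sq-nonarc : ∀ u w → ¬ (u ≡ w) → A u w ≡ false → paths2 A u w ≡ μ

complement : ∀ {n} → Digraph n → Digraph n
complement A u v = not ⌊ u F.≟ v ⌋ ∧ not (A u v)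

-- An ordered partition {C_1,…,C_a} of Fin n into a cells is given by the
-- cell-assignment map c : Fin n → Fin a  (v ∈ C_{i+1}  iff  c v ≡ i).
Partition : ℕ → ℕ → Set
Partition n a = Fin n → Fin a

cellMember : ∀ {n a} → Partition n a → Fin a → Fin n → Bool
cellMember c i v = ⌊ c v F.≟ i ⌋

-- homogeneous: every cell is nonempty (it is a partition) and all cells
-- have the same size.
IsHomogeneous : ∀ {n a} → Partition n a → Set
IsHomogeneous {n} {a} c =
  (∀ i → ∃ λ v → c v ≡ i) ×
  (∀ i j → count (cellMember c i) ≡ count (cellMember c j))

IsColumnEquitable : ∀ {n a} → Digraph n → Partition n a → Set
IsColumnEquitable {n} {a} A c =
  ∀ (i : Fin a) (v w : Fin n) → c v ≡ c w →
    count (λ u → cellMember c i u ∧ A u v) ≡ count (λ u → cellMember c i u ∧ A u w)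

-- For a pair (u,r),(v,s):
--   if r = s  : arc iff u → v in Γ;
--   otherwise : arc iff s ≡ r + i (mod a+1) where v ∈ C_i (i = c v + 1).
-- (These two cases are exclusive since 1 ≤ i ≤ a.)
joinAdj : ∀ {n a} → Digraph n → Partition n a →
          Fin n × Fin (suc a) → Fin n × Fin (suc a) → Bool
joinAdj {n} {a} A c (u , r) (v , s) =
  if ⌊ r F.≟ s ⌋ then A u v
  else ⌊ toℕ s ℕ.≟ (toℕ r + suc (toℕ (c v))) % suc a ⌋

-- The π-join as a digraph on Fin (n * (a+1)), identified with
-- Fin n × Fin (a+1) via the standard bijection remQuot.
join : ∀ {n a} → Digraph n → Partition n a → Digraph (n * suc a)
join {n} {a} A c x y = joinAdj A c (remQuot (suc a) x) (remQuot (suc a) y)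

IsDSRG' : ∀ {n} → Digraph n → Set
IsDSRG' A = ∃ λ k → ∃ λ t → ∃ λ l → ∃ λ m → IsDSRG A k t l m

IsGood : ∀ {n a} → Digraph n → Partition n a → Set
IsGood A c = IsDSRG' (join A c)

-- The complement of a π-join is again a π-join, up to relabelling.
--
-- Let π have two cells, so the π-join has three layers 0,1,2.  Between two
-- distinct layers r ≠ s the join has an arc (u,r) → (v,s) iff s − r ≡ i
-- (mod 3), where v ∈ C_i and i ∈ {1,2}; since s − r ∈ {1,2}, the complement
-- of the join has such an arc iff r − s ≡ i.  Inside a layer the complement
-- of the join is the complement of Γ.  Hence mirroring the layers, r ↦ −r,
-- is an isomorphism from the π-join of Γ̄ onto the complement of the π-join
-- of Γ.  The corollary therefore follows from two general facts:
--   (1) the complement of a DSRG is a DSRG (computed with integer sums,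
--       writing J − I − A entrywise as 1 − δ − a), and
--   (2) being a DSRG is invariant under relabelling the vertices.
-- In particular the conclusion holds for every two-cell partition.
module Submission where

open import Defs
open import Data.Nat using (ℕ; _+_; _*_)
open import Relation.Binary.PropositionalEquality using (_≡_)

import Data.Nat as ℕ
open import Data.Nat.DivMod using (_%_)
open import Data.Integer using (ℤ; +_; ∣_∣; 0ℤ; 1ℤ)
  renaming (_+_ to _+ℤ_; _-_ to _-ℤ_; _*_ to _*ℤ_; -_ to negate)
import Data.Integer.Properties as ℤP
open import Data.Integer.Tactic.RingSolver using (solve-∀)
open import Algebra.Properties.Semiring.Sum ℤP.+-*-semiring
  using (sum; sum-syntax; ∑-distrib-+; sum-cong-≗; sum-replicate-zero; sum-permute)
open import Data.Bool using (Bool; true; false; _∧_; not; if_then_else_)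
open import Data.Bool.Properties using (∧-identityʳ; ∧-zeroʳ)
open import Data.Fin using (Fin; zero; suc; toℕ; remQuot; combine)
import Data.Fin as F
open import Data.Fin.Patterns using (0F; 1F; 2F)
open import Data.Fin.Properties using (remQuot-combine; combine-remQuot; combine-injective)
open import Data.Fin.Permutation using (Permutation; permutation; _⟨$⟩ʳ_; _⟨$⟩ˡ_; inverseˡ)
open import Data.Product using (_×_; _,_; proj₁; proj₂; uncurry)
open import Relation.Binary.PropositionalEquality
  using (refl; sym; trans; cong; cong₂; module ≡-Reasoning)
open import Relation.Nullary using (¬_; Dec; yes; no)
open import Relation.Nullary.Decidable using (⌊_⌋; isYes≗does; dec-true; dec-false)
open import Function using (_∘_)

open ≡-Reasoning

⟦_⟧ : Bool → ℤ
⟦ true ⟧ = 1ℤ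
⟦ false ⟧ = 0ℤ

⟦∧⟧ : ∀ b c → ⟦ b ∧ c ⟧ ≡ ⟦ b ⟧ *ℤ ⟦ c ⟧
⟦∧⟧ true c = sym (ℤP.*-identityˡ ⟦ c ⟧)
⟦∧⟧ false c = refl

-- Counting is summing indicators; this moves every count into the ring ℤ.
count-as-sum : ∀ {N} (p : Fin N → Bool) → + count p ≡ ∑[ i < N ] ⟦ p i ⟧
count-as-sum {ℕ.zero} p = refl
count-as-sum {ℕ.suc N} p = begin
  + ((if p zero then 1 else 0) + count (p ∘ suc))
    ≡⟨ sym (ℤP.pos-+ _ (count (p ∘ suc))) ⟩
  + (if p zero then 1 else 0) +ℤ + count (p ∘ suc)
    ≡⟨ cong₂ _+ℤ_ (indicator (p zero)) (count-as-sum (p ∘ suc)) ⟩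
  ⟦ p zero ⟧ +ℤ ∑[ i < N ] ⟦ p (suc i) ⟧ ∎
  where
  indicator : ∀ b → + (if b then 1 else 0) ≡ ⟦ b ⟧
  indicator true = refl
  indicator false = refl

count-via-sum : ∀ {M N} (p : Fin M → Bool) (q : Fin N → Bool) →
  ∑[ i < M ] ⟦ p i ⟧ ≡ ∑[ i < N ] ⟦ q i ⟧ → count p ≡ count q
count-via-sum p q e =
  ℤP.+-injective (trans (count-as-sum p) (trans e (sym (count-as-sum q))))

count-cong : ∀ {N} {p q : Fin N → Bool} → (∀ i → p i ≡ q i) → count p ≡ count q
count-cong {p = p} {q} e = count-via-sum p q (sum-cong-≗ (cong ⟦_⟧ ∘ e))

sum-neg : ∀ {N} (f : Fin N → ℤ) → ∑[ i < N ] (negate (f i)) ≡ negate (sum f)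
sum-neg {ℕ.zero} f = refl
sum-neg {ℕ.suc N} f = begin
  negate (f zero) +ℤ ∑[ i < N ] negate (f (suc i))
    ≡⟨ cong (negate (f zero) +ℤ_) (sum-neg (f ∘ suc)) ⟩
  negate (f zero) +ℤ negate (sum (f ∘ suc))
    ≡⟨ sym (ℤP.neg-distrib-+ (f zero) _) ⟩
  negate (f zero +ℤ sum (f ∘ suc)) ∎

sum-sub : ∀ {N} (f g : Fin N → ℤ) → ∑[ i < N ] (f i -ℤ g i) ≡ sum f -ℤ sum g
sum-sub f g = trans (∑-distrib-+ f (negate ∘ g)) (cong (sum f +ℤ_) (sum-neg g))

sum-one : ∀ N → ∑[ i < N ] 1ℤ ≡ + N
sum-one ℕ.zero = refl
sum-one (ℕ.suc N) = trans (cong (1ℤ +ℤ_) (sum-one N)) (ℤP.pos-+ 1 N)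

δ : ∀ {N} → Fin N → Fin N → ℤ
δ u x = ⟦ ⌊ u F.≟ x ⌋ ⟧

⌊⌋-yes : ∀ {P : Set} (d : Dec P) → P → ⌊ d ⌋ ≡ true
⌊⌋-yes d p = trans (isYes≗does d) (dec-true d p)

⌊⌋-no : ∀ {P : Set} (d : Dec P) → ¬ P → ⌊ d ⌋ ≡ false
⌊⌋-no d ¬p = trans (isYes≗does d) (dec-false d ¬p)

⌊⌋-false : ∀ {P : Set} (d : Dec P) → ⌊ d ⌋ ≡ false → ¬ P
⌊⌋-false (no ¬p) _ = ¬p

δ-suc : ∀ {N} (u x : Fin N) → δ (suc u) (suc x) ≡ δ u x
δ-suc u x with u F.≟ x
... | yes _ = refl
... | no _ = refl

δ-sym : ∀ {N} (u x : Fin N) → δ u x ≡ δ x u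
δ-sym u x with u F.≟ x
... | yes refl = cong ⟦_⟧ (sym (⌊⌋-yes (u F.≟ u) refl))
... | no u≢x = cong ⟦_⟧ (sym (⌊⌋-no (x F.≟ u) (u≢x ∘ sym)))

sift : ∀ {N} (u : Fin N) (f : Fin N → ℤ) → ∑[ x < N ] (δ u x *ℤ f x) ≡ f u
sift {ℕ.suc N} zero f = begin
  1ℤ *ℤ f zero +ℤ ∑[ x < N ] (0ℤ *ℤ f (suc x)) ≡⟨ cong₂ _+ℤ_ (ℤP.*-identityˡ (f zero)) rest ⟩
  f zero +ℤ 0ℤ                                  ≡⟨ ℤP.+-identityʳ (f zero) ⟩
  f zero                                        ∎
  where
  rest : ∑[ x < N ] (0ℤ *ℤ f (suc x)) ≡ 0ℤ
  rest = trans (sum-cong-≗ (λ x → ℤP.*-zeroˡ (f (suc x)))) (sum-replicate-zero N)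
sift {ℕ.suc N} (suc u) f = begin
  0ℤ *ℤ f zero +ℤ ∑[ x < N ] (δ (suc u) (suc x) *ℤ f (suc x))
    ≡⟨ cong (0ℤ +ℤ_) (sum-cong-≗ (λ x → cong (_*ℤ f (suc x)) (δ-suc u x))) ⟩
  0ℤ +ℤ ∑[ x < N ] (δ u x *ℤ f (suc x))
    ≡⟨ ℤP.+-identityˡ _ ⟩
  ∑[ x < N ] (δ u x *ℤ f (suc x))
    ≡⟨ sift u (f ∘ suc) ⟩
  f (suc u) ∎

sum-complement-row : ∀ {N} (u : Fin N) (a g : Fin N → ℤ) →
  ∑[ x < N ] ((1ℤ -ℤ δ u x -ℤ a x) *ℤ g x) ≡ sum g -ℤ g u -ℤ ∑[ x < N ] (a x *ℤ g x)
sum-complement-row {N} u a g = begin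
  ∑[ x < N ] ((1ℤ -ℤ δ u x -ℤ a x) *ℤ g x)
    ≡⟨ sum-cong-≗ (λ x → expand (δ u x) (a x) (g x)) ⟩
  ∑[ x < N ] (g x -ℤ δ u x *ℤ g x -ℤ a x *ℤ g x)
    ≡⟨ sum-sub (λ x → g x -ℤ δ u x *ℤ g x) (λ x → a x *ℤ g x) ⟩
  ∑[ x < N ] (g x -ℤ δ u x *ℤ g x) -ℤ ∑[ x < N ] (a x *ℤ g x)
    ≡⟨ cong (_-ℤ ∑[ x < N ] (a x *ℤ g x)) (trans (sum-sub g _) (cong (sum g -ℤ_) (sift u g))) ⟩
  sum g -ℤ g u -ℤ ∑[ x < N ] (a x *ℤ g x) ∎
  where
  expand : ∀ d α y → (1ℤ -ℤ d -ℤ α) *ℤ y ≡ y -ℤ d *ℤ y -ℤ α *ℤ y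
  expand = solve-∀

sum-complement-column : ∀ {N} (w : Fin N) (a f : Fin N → ℤ) →
  ∑[ x < N ] (f x *ℤ (1ℤ -ℤ δ x w -ℤ a x)) ≡ sum f -ℤ f w -ℤ ∑[ x < N ] (f x *ℤ a x)
sum-complement-column {N} w a f = begin
  ∑[ x < N ] (f x *ℤ (1ℤ -ℤ δ x w -ℤ a x))
    ≡⟨ sum-cong-≗ (λ x → trans (ℤP.*-comm (f x) _) (cong (λ d → (1ℤ -ℤ d -ℤ a x) *ℤ f x) (δ-sym x w))) ⟩
  ∑[ x < N ] ((1ℤ -ℤ δ w x -ℤ a x) *ℤ f x)
    ≡⟨ sum-complement-row w a f ⟩
  sum f -ℤ f w -ℤ ∑[ x < N ] (a x *ℤ f x)
    ≡⟨ cong (sum f -ℤ f w -ℤ_) (sum-cong-≗ (λ x → ℤP.*-comm (a x) (f x))) ⟩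
  sum f -ℤ f w -ℤ ∑[ x < N ] (f x *ℤ a x) ∎

module ComplementOfDSRG {N : ℕ} (A : Digraph N) {k t λ' μ : ℕ} (D : IsDSRG A k t λ' μ) where
  open IsDSRG D

  a ā : Fin N → Fin N → ℤ
  a u x = ⟦ A u x ⟧
  ā u x = ⟦ complement A u x ⟧

  -- J − I − A entrywise; on the diagonal this uses that A is loopless.
  ā-entry : ∀ u x → ā u x ≡ 1ℤ -ℤ δ u x -ℤ a u x
  ā-entry u x with u F.≟ x
  ... | yes refl rewrite loopless u = refl
  ... | no _ with A u x
  ...   | true = refl
  ...   | false = refl

  a-row-sum : ∀ u → ∑[ x < N ] a u x ≡ + k
  a-row-sum u = trans (sym (count-as-sum (A u))) (cong +_ (outDegree u))

  a-column-sum : ∀ w → ∑[ x < N ] a x w ≡ + k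
  a-column-sum w = trans (sym (count-as-sum (λ x → A x w))) (cong +_ (inDegree w))

  ā-row-sum : ∀ u → ∑[ x < N ] ā u x ≡ + N -ℤ 1ℤ -ℤ + k
  ā-row-sum u = begin
    ∑[ x < N ] ā u x
      ≡⟨ sum-cong-≗ (λ x → trans (ā-entry u x) (sym (ℤP.*-identityʳ _))) ⟩
    ∑[ x < N ] ((1ℤ -ℤ δ u x -ℤ a u x) *ℤ 1ℤ)
      ≡⟨ sum-complement-row u (a u) (λ _ → 1ℤ) ⟩
    ∑[ x < N ] 1ℤ -ℤ 1ℤ -ℤ ∑[ x < N ] (a u x *ℤ 1ℤ)
      ≡⟨ cong₂ (λ s r → s -ℤ 1ℤ -ℤ r) (sum-one N)
               (trans (sum-cong-≗ (λ x → ℤP.*-identityʳ (a u x))) (a-row-sum u)) ⟩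
    + N -ℤ 1ℤ -ℤ + k ∎

  ā-column-sum : ∀ w → ∑[ x < N ] ā x w ≡ + N -ℤ 1ℤ -ℤ + k
  ā-column-sum w = begin
    ∑[ x < N ] ā x w
      ≡⟨ sum-cong-≗ (λ x → trans (ā-entry x w) (sym (ℤP.*-identityˡ _))) ⟩
    ∑[ x < N ] (1ℤ *ℤ (1ℤ -ℤ δ x w -ℤ a x w))
      ≡⟨ sum-complement-column w (λ x → a x w) (λ _ → 1ℤ) ⟩
    ∑[ x < N ] 1ℤ -ℤ 1ℤ -ℤ ∑[ x < N ] (1ℤ *ℤ a x w)
      ≡⟨ cong₂ (λ s r → s -ℤ 1ℤ -ℤ r) (sum-one N)
               (trans (sum-cong-≗ (λ x → ℤP.*-identityˡ (a x w))) (a-column-sum w)) ⟩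
    + N -ℤ 1ℤ -ℤ + k ∎

  a²-entry : ∀ u w → ∑[ x < N ] (a u x *ℤ a x w) ≡ + paths2 A u w
  a²-entry u w = sym (trans (count-as-sum (λ x → A u x ∧ A x w)) (sum-cong-≗ (λ x → ⟦∧⟧ (A u x) (A x w))))

  two-paths : ∀ u w →
    + paths2 (complement A) u w ≡ + N -ℤ + 2 -ℤ + 2 *ℤ + k +ℤ δ u w +ℤ + 2 *ℤ a u w +ℤ + paths2 A u w
  two-paths u w = begin
    + paths2 (complement A) u w
      ≡⟨ count-as-sum (λ x → complement A u x ∧ complement A x w) ⟩
    ∑[ x < N ] ⟦ complement A u x ∧ complement A x w ⟧
      ≡⟨ sum-cong-≗ (λ x → trans (⟦∧⟧ (complement A u x) (complement A x w)) (cong (_*ℤ ā x w) (ā-entry u x))) ⟩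
    ∑[ x < N ] ((1ℤ -ℤ δ u x -ℤ a u x) *ℤ ā x w)
      ≡⟨ sum-complement-row u (a u) (λ x → ā x w) ⟩
    ∑[ x < N ] ā x w -ℤ ā u w -ℤ ∑[ x < N ] (a u x *ℤ ā x w)
      ≡⟨ cong₂ (λ s r → s -ℤ ā u w -ℤ r) (ā-column-sum w) a-times-ā ⟩
    (+ N -ℤ 1ℤ -ℤ + k) -ℤ ā u w -ℤ (+ k -ℤ a u w -ℤ + paths2 A u w)
      ≡⟨ cong (λ e → (+ N -ℤ 1ℤ -ℤ + k) -ℤ e -ℤ (+ k -ℤ a u w -ℤ + paths2 A u w)) (ā-entry u w) ⟩
    (+ N -ℤ 1ℤ -ℤ + k) -ℤ (1ℤ -ℤ δ u w -ℤ a u w) -ℤ (+ k -ℤ a u w -ℤ + paths2 A u w)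
      ≡⟨ collect (+ N) (+ k) (δ u w) (a u w) (+ paths2 A u w) ⟩
    + N -ℤ + 2 -ℤ + 2 *ℤ + k +ℤ δ u w +ℤ + 2 *ℤ a u w +ℤ + paths2 A u w ∎
    where
    a-times-ā : ∑[ x < N ] (a u x *ℤ ā x w) ≡ + k -ℤ a u w -ℤ + paths2 A u w
    a-times-ā = begin
      ∑[ x < N ] (a u x *ℤ ā x w)
        ≡⟨ sum-cong-≗ (λ x → cong (a u x *ℤ_) (ā-entry x w)) ⟩
      ∑[ x < N ] (a u x *ℤ (1ℤ -ℤ δ x w -ℤ a x w))
        ≡⟨ sum-complement-column w (λ x → a x w) (a u) ⟩
      ∑[ x < N ] a u x -ℤ a u w -ℤ ∑[ x < N ] (a u x *ℤ a x w)
        ≡⟨ cong₂ (λ s r → s -ℤ a u w -ℤ r) (a-row-sum u) (a²-entry u w) ⟩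
      + k -ℤ a u w -ℤ + paths2 A u w ∎

    collect : ∀ n κ d α p → (n -ℤ 1ℤ -ℤ κ) -ℤ (1ℤ -ℤ d -ℤ α) -ℤ (κ -ℤ α -ℤ p)
                           ≡ n -ℤ + 2 -ℤ + 2 *ℤ κ +ℤ d +ℤ + 2 *ℤ α +ℤ p
    collect = solve-∀

  two-paths-at : ∀ {u w} {d α : ℤ} {p : ℕ} → δ u w ≡ d → a u w ≡ α → paths2 A u w ≡ p →
    + paths2 (complement A) u w ≡ + N -ℤ + 2 -ℤ + 2 *ℤ + k +ℤ d +ℤ + 2 *ℤ α +ℤ + p
  two-paths-at {u} {w} refl refl refl = two-paths u w

  complement-arc : ∀ u w → complement A u w ≡ true → (⌊ u F.≟ w ⌋ ≡ false) × (A u w ≡ false)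
  complement-arc u w e = neither ⌊ u F.≟ w ⌋ (A u w) e
    where
    neither : ∀ b c → not b ∧ not c ≡ true → (b ≡ false) × (c ≡ false)
    neither false false _ = refl , refl

  complement-nonarc : ∀ u w → ¬ u ≡ w → complement A u w ≡ false → A u w ≡ true
  complement-nonarc u w u≢w e =
    not-false-true (A u w) (trans (sym (cong (λ b → not b ∧ not (A u w)) u≠w)) e)
    where
    u≠w : ⌊ u F.≟ w ⌋ ≡ false
    u≠w = ⌊⌋-no (u F.≟ w) u≢w
    not-false-true : ∀ c → not false ∧ not c ≡ false → c ≡ true
    not-false-true true _ = refl

  kᶜ tᶜ λᶜ μᶜ : ℕ
  kᶜ = ∣ + N -ℤ 1ℤ -ℤ + k ∣
  tᶜ = ∣ + N -ℤ + 2 *ℤ + k +ℤ + t -ℤ 1ℤ ∣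
  λᶜ = ∣ + N -ℤ + 2 *ℤ + k +ℤ + μ -ℤ + 2 ∣
  μᶜ = ∣ + N -ℤ + 2 *ℤ + k +ℤ + λ' ∣

  isDSRG : IsDSRG (complement A) kᶜ tᶜ λᶜ μᶜ
  isDSRG = record
    { loopless  = λ v → cong (λ b → not b ∧ not (A v v)) (⌊⌋-yes (v F.≟ v) refl)
    ; outDegree = λ u → cong ∣_∣ (trans (count-as-sum (complement A u)) (ā-row-sum u))
    ; inDegree  = λ w → cong ∣_∣ (trans (count-as-sum (λ x → complement A x w)) (ā-column-sum w))
    ; sq-diag   = diagonal
    ; sq-arc    = arc
    ; sq-nonarc = nonarc
    }
    where
    diagonal : ∀ u → paths2 (complement A) u u ≡ tᶜ
    diagonal u = cong ∣_∣ (trans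
      (two-paths-at (cong ⟦_⟧ (⌊⌋-yes (u F.≟ u) refl)) (cong ⟦_⟧ (loopless u)) (sq-diag u))
      (simplify (+ N) (+ k) (+ t)))
      where
      simplify : ∀ n κ p → n -ℤ + 2 -ℤ + 2 *ℤ κ +ℤ 1ℤ +ℤ + 2 *ℤ 0ℤ +ℤ p ≡ n -ℤ + 2 *ℤ κ +ℤ p -ℤ 1ℤ
      simplify = solve-∀

    arc : ∀ u w → complement A u w ≡ true → paths2 (complement A) u w ≡ λᶜ
    arc u w e = cong ∣_∣ (trans
      (two-paths-at (cong ⟦_⟧ u≠w) (cong ⟦_⟧ no-arc) (sq-nonarc u w (⌊⌋-false (u F.≟ w) u≠w) no-arc))
      (simplify (+ N) (+ k) (+ μ)))
      where
      u≠w : ⌊ u F.≟ w ⌋ ≡ false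
      u≠w = proj₁ (complement-arc u w e)
      no-arc : A u w ≡ false
      no-arc = proj₂ (complement-arc u w e)
      simplify : ∀ n κ p → n -ℤ + 2 -ℤ + 2 *ℤ κ +ℤ 0ℤ +ℤ + 2 *ℤ 0ℤ +ℤ p ≡ n -ℤ + 2 *ℤ κ +ℤ p -ℤ + 2
      simplify = solve-∀

    nonarc : ∀ u w → ¬ u ≡ w → complement A u w ≡ false → paths2 (complement A) u w ≡ μᶜ
    nonarc u w u≢w e = cong ∣_∣ (trans
      (two-paths-at (cong ⟦_⟧ (⌊⌋-no (u F.≟ w) u≢w)) (cong ⟦_⟧ has-arc) (sq-arc u w has-arc))
      (simplify (+ N) (+ k) (+ λ')))
      where
      has-arc : A u w ≡ true
      has-arc = complement-nonarc u w u≢w e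
      simplify : ∀ n κ p → n -ℤ + 2 -ℤ + 2 *ℤ κ +ℤ 0ℤ +ℤ + 2 *ℤ 1ℤ +ℤ p ≡ n -ℤ + 2 *ℤ κ +ℤ p
      simplify = solve-∀

count-permute : ∀ {N} (ρ : Permutation N N) (p : Fin N → Bool) → count (p ∘ (ρ ⟨$⟩ʳ_)) ≡ count p
count-permute ρ p = count-via-sum (p ∘ (ρ ⟨$⟩ʳ_)) p (sym (sum-permute (⟦_⟧ ∘ p) ρ))

isDSRG-relabel : ∀ {N} (ρ : Permutation N N) {B B' : Digraph N} →
  (∀ x y → B' x y ≡ B (ρ ⟨$⟩ʳ x) (ρ ⟨$⟩ʳ y)) →
  ∀ {k t λ' μ} → IsDSRG B k t λ' μ → IsDSRG B' k t λ' μ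
isDSRG-relabel ρ {B} {B'} pullback D = record
  { loopless  = λ v → trans (pullback v v) (loopless (ρ ⟨$⟩ʳ v))
  ; outDegree = λ u → trans (count-cong (pullback u))
      (trans (count-permute ρ (B (ρ ⟨$⟩ʳ u))) (outDegree (ρ ⟨$⟩ʳ u)))
  ; inDegree  = λ w → trans (count-cong (λ x → pullback x w))
      (trans (count-permute ρ (λ y → B y (ρ ⟨$⟩ʳ w))) (inDegree (ρ ⟨$⟩ʳ w)))
  ; sq-diag   = λ u → trans (two-paths u u) (sq-diag (ρ ⟨$⟩ʳ u))
  ; sq-arc    = λ u w uw → trans (two-paths u w)
      (sq-arc (ρ ⟨$⟩ʳ u) (ρ ⟨$⟩ʳ w) (trans (sym (pullback u w)) uw))
  ; sq-nonarc = λ u w u≢w uw → trans (two-paths u w)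
      (sq-nonarc (ρ ⟨$⟩ʳ u) (ρ ⟨$⟩ʳ w) (u≢w ∘ ρ-injective) (trans (sym (pullback u w)) uw))
  }
  where
  open IsDSRG D

  two-paths : ∀ u w → paths2 B' u w ≡ paths2 B (ρ ⟨$⟩ʳ u) (ρ ⟨$⟩ʳ w)
  two-paths u w = trans (count-cong (λ x → cong₂ _∧_ (pullback u x) (pullback x w)))
    (count-permute ρ (λ y → B (ρ ⟨$⟩ʳ u) y ∧ B y (ρ ⟨$⟩ʳ w)))

  ρ-injective : ∀ {u w} → ρ ⟨$⟩ʳ u ≡ ρ ⟨$⟩ʳ w → u ≡ w
  ρ-injective e = trans (sym (inverseˡ ρ)) (trans (cong (ρ ⟨$⟩ˡ_) e) (inverseˡ ρ))

≟-combine : ∀ {n m} (u v : Fin n) (r s : Fin m) →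
  ⌊ combine u r F.≟ combine v s ⌋ ≡ ⌊ u F.≟ v ⌋ ∧ ⌊ r F.≟ s ⌋
≟-combine u v r s with u F.≟ v | r F.≟ s
... | yes refl | yes refl = ⌊⌋-yes (combine u r F.≟ combine u r) refl
... | yes refl | no r≢s = ⌊⌋-no (combine u r F.≟ combine u s) (r≢s ∘ proj₂ ∘ combine-injective u r u s)
... | no u≢v | _ = ⌊⌋-no (combine u r F.≟ combine v s) (u≢v ∘ proj₁ ∘ combine-injective u r v s)

module LayerInvolution {n m : ℕ} (ρ : Fin m → Fin m) (ρ-involutive : ∀ r → ρ (ρ r) ≡ r) where

  onLayers : Fin (n * m) → Fin (n * m)
  onLayers x = combine (proj₁ (remQuot {n} m x)) (ρ (proj₂ (remQuot {n} m x)))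

  remQuot-onLayers : ∀ x → remQuot {n} m (onLayers x) ≡ (proj₁ (remQuot {n} m x) , ρ (proj₂ (remQuot {n} m x)))
  remQuot-onLayers x = remQuot-combine _ _

  onLayers-involutive : ∀ x → onLayers (onLayers x) ≡ x
  onLayers-involutive x = begin
    onLayers (onLayers x)
      ≡⟨ cong (λ p → combine (proj₁ p) (ρ (proj₂ p))) (remQuot-onLayers x) ⟩
    combine (proj₁ (remQuot {n} m x)) (ρ (ρ (proj₂ (remQuot {n} m x))))
      ≡⟨ cong (combine {n} {m} (proj₁ (remQuot {n} m x))) (ρ-involutive (proj₂ (remQuot {n} m x))) ⟩
    uncurry combine (remQuot {n} m x)
      ≡⟨ combine-remQuot {n} m x ⟩
    x ∎

  permuteLayers : Permutation (n * m) (n * m)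
  permuteLayers = permutation onLayers onLayers onLayers-involutive onLayers-involutive

-- Between layers
-- r ≠ s, the arc (u,r) → (v,s) exists iff s ≡ r + c + 1 (mod 3), where
-- v lies in the cell with index c (this is joinAdj off the diagonal).
crossArc : Fin 2 → Fin 3 → Fin 3 → Bool
crossArc c r s = ⌊ toℕ s ℕ.≟ (toℕ r + ℕ.suc (toℕ c)) % 3 ⌋

mirror : Fin 3 → Fin 3
mirror 0F = 0F
mirror 1F = 2F
mirror 2F = 1F

mirror-involutive : ∀ r → mirror (mirror r) ≡ r
mirror-involutive 0F = refl
mirror-involutive 1F = refl
mirror-involutive 2F = refl

mirror-injective : ∀ {r s} → mirror r ≡ mirror s → r ≡ s
mirror-injective {r} {s} e = trans (sym (mirror-involutive r)) (trans (cong mirror e) (mirror-involutive s))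

-- Between distinct layers exactly one of s − r, r − s equals c + 1 (mod 3):
-- mirroring the layers complements the cross-layer arcs.
crossArc-mirror : ∀ c r s → ¬ r ≡ s → crossArc c r s ≡ not (crossArc c (mirror r) (mirror s))
crossArc-mirror c 0F 0F r≢s with () ← r≢s refl
crossArc-mirror c 1F 1F r≢s with () ← r≢s refl
crossArc-mirror c 2F 2F r≢s with () ← r≢s refl
crossArc-mirror 0F 0F 1F _ = refl
crossArc-mirror 0F 0F 2F _ = refl
crossArc-mirror 0F 1F 0F _ = refl
crossArc-mirror 0F 1F 2F _ = refl
crossArc-mirror 0F 2F 0F _ = refl
crossArc-mirror 0F 2F 1F _ = refl
crossArc-mirror 1F 0F 1F _ = refl
crossArc-mirror 1F 0F 2F _ = refl
crossArc-mirror 1F 1F 0F _ = refl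
crossArc-mirror 1F 1F 2F _ = refl
crossArc-mirror 1F 2F 0F _ = refl
crossArc-mirror 1F 2F 1F _ = refl

joinAdj-complement : ∀ {n} (A : Digraph n) (π : Partition n 2) u r v s →
  joinAdj (complement A) π (u , r) (v , s)
    ≡ not (⌊ u F.≟ v ⌋ ∧ ⌊ mirror r F.≟ mirror s ⌋) ∧ not (joinAdj A π (u , mirror r) (v , mirror s))
joinAdj-complement A π u r v s with r F.≟ s | mirror r F.≟ mirror s
... | yes refl | yes _ = cong (λ b → not b ∧ not (A u v)) (sym (∧-identityʳ ⌊ u F.≟ v ⌋))
... | yes refl | no m≢m with () ← m≢m refl
... | no r≢s | yes mr≡ms with () ← r≢s (mirror-injective mr≡ms)
... | no r≢s | no _ = begin
  crossArc (π v) r s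
    ≡⟨ crossArc-mirror (π v) r s r≢s ⟩
  not (crossArc (π v) (mirror r) (mirror s))
    ≡⟨ cong (λ b → not b ∧ not (crossArc (π v) (mirror r) (mirror s))) (sym (∧-zeroʳ ⌊ u F.≟ v ⌋)) ⟩
  not (⌊ u F.≟ v ⌋ ∧ false) ∧ not (crossArc (π v) (mirror r) (mirror s)) ∎

module MirrorLayers {n : ℕ} = LayerInvolution {n} {3} mirror mirror-involutive

join-complement : ∀ {n} (A : Digraph n) (π : Partition n 2) x y →
  join (complement A) π x y ≡
    complement (join A π) (MirrorLayers.permuteLayers {n} ⟨$⟩ʳ x) (MirrorLayers.permuteLayers {n} ⟨$⟩ʳ y)
join-complement {n} A π x y = begin
  joinAdj (complement A) π (u , r) (v , s)
    ≡⟨ joinAdj-complement A π u r v s ⟩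
  not (⌊ u F.≟ v ⌋ ∧ ⌊ mirror r F.≟ mirror s ⌋) ∧ not (joinAdj A π (u , mirror r) (v , mirror s))
    ≡⟨ cong₂ (λ b p → not b ∧ not (joinAdj A π (proj₁ p) (proj₂ p)))
             (sym (≟-combine u v (mirror r) (mirror s)))
             (sym (cong₂ _,_ (remQuot-onLayers x) (remQuot-onLayers y))) ⟩
  complement (join A π) (onLayers x) (onLayers y) ∎
  where
  open MirrorLayers {n}
  u v : Fin n
  u = proj₁ (remQuot {n} 3 x)
  v = proj₁ (remQuot {n} 3 y)
  r s : Fin 3
  r = proj₂ (remQuot {n} 3 x)
  s = proj₂ (remQuot {n} 3 y)

corollary8 : (n k t λ' μ : ℕ) (A : Digraph n) → IsDSRG A k t λ' μ →
    2 * (μ + n + λ') ≡ n + 4 * k →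
    (π : Partition n 2) → IsHomogeneous π → IsColumnEquitable A π →
    IsGood A π → IsGood (complement A) π
corollary8 n k t λ' μ A _ _ π _ _ (_ , _ , _ , _ , joinIsDSRG) =
  _ , _ , _ , _ ,
  isDSRG-relabel (MirrorLayers.permuteLayers {n}) (join-complement A π)
    (ComplementOfDSRG.isDSRG (join A π) joinIsDSRG)
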